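{- Let $G$ be a connected graph and let $v$ be a cut-vertex of $G$, and let $G_1,\dots,G_c$ be the connected components of $G-\{v\}$. Then for any minimal fort $F$ of $G$ with $v\notin F$, at most two of the $G_i$ satisfy $V(G_i)\cap F\neq\emptyset$.
   Context: A fort of a finite simple graph $G$ is a nonempty set $F\subseteq V(G)$ such that every vertex not in $F$ is adjacent to either zero or at least two vertices of $F$; it is minimal if no proper subset is a fort. -}

module Defs where

open import Data.Nat using (ℕ; _≤_; _≡ᵇ_)
open import Data.Bool using (Bool; true; false)
open import Data.Fin using (Fin)
open import Data.Fin.Subset using (Subset; _∈_; _∉_; _∩_; _⊂_; Nonempty; ∣_∣)
open import Data.Vec using (tabulate)
open import Data.Unit using (⊤)
open import Data.Product using (Σ; _×_; ∃-syntax)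
open import Data.Sum using (_⊎_)
open import Relation.Nullary using (¬_)
open import Relation.Binary.PropositionalEquality using (_≡_; _≢_)

record Graph (n : ℕ) : Set where
  field
    adj   : Fin n → Fin n → Bool
    sym   : ∀ u w → adj u w ≡ adj w u
    irrefl : ∀ u → adj u u ≡ false

open Graph public

N : ∀ {n} → Graph n → Fin n → Subset n
N G u = tabulate (adj G u)

IsFort : ∀ {n} → Graph n → Subset n → Set
IsFort {n} G F =
  Nonempty F × (∀ u → u ∉ F → (∣ N G u ∩ F ∣ ≡ 0) ⊎ (2 ≤ ∣ N G u ∩ F ∣))

IsMinimalFort : ∀ {n} → Graph n → Subset n → Set
IsMinimalFort G F = IsFort G F × (∀ F′ → F′ ⊂ F → ¬ IsFort G F′)

-- Walks in G all of whose vertices satisfy P (i.e. walks in the induced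
-- subgraph G[P]).
data Walk {n} (G : Graph n) (P : Fin n → Set) : Fin n → Fin n → Set where
  here : ∀ {u} → P u → Walk G P u u
  step : ∀ {u w x} → P u → adj G u w ≡ true → Walk G P w x → Walk G P u x

Connected : ∀ {n} → Graph n → Set
Connected G = ∀ u w → Walk G (λ _ → ⊤) u w

SameComponentMinus : ∀ {n} → Graph n → Fin n → Fin n → Fin n → Set
SameComponentMinus G v u w = Walk G (λ x → x ≢ v) u w

IsCutVertex : ∀ {n} → Graph n → Fin n → Set
IsCutVertex G v =
  ∃[ a ] ∃[ b ] (a ≢ v × b ≢ v × ¬ SameComponentMinus G v a b)

module Submission where

-- Let F be a minimal fort avoiding v and C a component of G − v meeting F. If F also
-- meets another component, F′ = F ∖ C is a nonempty proper subset of F, and every vertex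
-- other than v satisfies the fort condition for F′: vertices of C have no neighbour in F′,
-- and any other vertex has the same neighbours in F′ as in F. By minimality the condition
-- must fail at v, so v has an F-neighbour in C and exactly one F-neighbour outside C.
-- If F met three components, of a, b and c, then v would have F-neighbours in the
-- components of b and of c, and removing the component of a would leave v two neighbours in F′.
-- As the goal is a negation, membership in a component may be decided classically.

open import Defs hiding (sym)
open import Data.Nat using (ℕ; zero; suc; _≤_)
open import Data.Bool using (Bool; true)
open import Data.Fin using (Fin; zero; suc; _≟_)
open import Data.Fin.Subset using (Subset; _∈_; _∉_; _∩_; ∁; _⊂_; Nonempty; Empty; ∣_∣; ⁅_⁆)
open import Data.Fin.Subset.Properties
  using (Empty-unique; ∣⊥∣≡0; ∣⁅x⁆∣≡1; x∈⁅y⁆⇒x≡y; x≢y⇒x∉⁅y⁆; p⊂q⇒∣p∣<∣q∣; ⊆-antisym;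
         ∩-assoc; p∩q⊆p; x∈p∩q⁺; x∈p∩q⁻; x∉p⇒x∈∁p; x∈∁p⇒x∉p)
open import Data.Vec using (tabulate)
open import Data.Vec.Properties using (lookup∘tabulate; []=⇒lookup; lookup⇒[]=)
open import Data.Product using (_×_; ∃-syntax; _,_; proj₁; proj₂)
open import Data.Sum using (_⊎_; inj₁; inj₂)
open import Function using (_∘_)
open import Level using (Level)
open import Relation.Nullary using (¬_; yes; no; does)
open import Relation.Nullary.Decidable using (dec-true; ¬¬-excluded-middle)
open import Relation.Unary using (Pred; Decidable)
open import Relation.Binary.PropositionalEquality using (_≡_; _≢_; refl; sym; trans; cong; subst; module ≡-Reasoning)

private
  variable
    ℓ : Level
    n : ℕ

¬¬-decidable : (P : Pred (Fin n) ℓ) → ¬ ¬ Decidable P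
¬¬-decidable {n = zero}  P k = k (λ ())
¬¬-decidable {n = suc n} P k =
  ¬¬-excluded-middle λ P0? → ¬¬-decidable (P ∘ suc) λ P? →
  k λ { zero → P0? ; (suc i) → P? i }

x∈tabulate⁺ : (f : Fin n → Bool) {x : Fin n} → f x ≡ true → x ∈ tabulate f
x∈tabulate⁺ f {x} fx = lookup⇒[]= x (tabulate f) (trans (lookup∘tabulate f x) fx)

x∈tabulate⁻ : (f : Fin n → Bool) {x : Fin n} → x ∈ tabulate f → f x ≡ true
x∈tabulate⁻ f {x} x∈f = trans (sym (lookup∘tabulate f x)) ([]=⇒lookup x∈f)

toSubset : {P : Pred (Fin n) ℓ} → Decidable P → Subset n
toSubset P? = tabulate (does ∘ P?)

module _ {P : Pred (Fin n) ℓ} (P? : Decidable P) where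

  x∈toSubset⁺ : ∀ {x} → P x → x ∈ toSubset P?
  x∈toSubset⁺ {x} px = x∈tabulate⁺ (does ∘ P?) (dec-true (P? x) px)

  x∈toSubset⁻ : ∀ {x} → x ∈ toSubset P? → P x
  x∈toSubset⁻ {x} x∈P with P? x | x∈tabulate⁻ (does ∘ P?) x∈P
  ... | yes px | _  = px
  ... | no _   | ()

Empty⇒∣p∣≡0 : {p : Subset n} → Empty p → ∣ p ∣ ≡ 0
Empty⇒∣p∣≡0 {n} empty = trans (cong ∣_∣ (Empty-unique empty)) (∣⊥∣≡0 n)

x∈p∧y∈p∧x≢y⇒2≤∣p∣ : {p : Subset n} {x y : Fin n} → x ∈ p → y ∈ p → x ≢ y → 2 ≤ ∣ p ∣
x∈p∧y∈p∧x≢y⇒2≤∣p∣ {p = p} {x} {y} x∈p y∈p x≢y =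
  subst (λ k → suc k ≤ ∣ p ∣) (∣⁅x⁆∣≡1 x) (p⊂q⇒∣p∣<∣q∣ (⁅x⁆⊆p , y , y∈p , x≢y⇒x∉⁅y⁆ (x≢y ∘ sym)))
  where
  ⁅x⁆⊆p : ∀ {z} → z ∈ ⁅ x ⁆ → z ∈ p
  ⁅x⁆⊆p z∈⁅x⁆ = subst (_∈ p) (sym (x∈⁅y⁆⇒x≡y x z∈⁅x⁆)) x∈p

p∩∁q≡p : {p q : Subset n} → (∀ {x} → x ∈ p → x ∉ q) → p ∩ ∁ q ≡ p
p∩∁q≡p {p = p} {q} disjoint =
  ⊆-antisym (p∩q⊆p p (∁ q)) (λ x∈p → x∈p∩q⁺ (x∈p , x∉p⇒x∈∁p (disjoint x∈p)))

module _ {G : Graph n} {P : Fin n → Set} where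

  extend : ∀ {u w x} → Walk G P u w → adj G w x ≡ true → P x → Walk G P u x
  extend (here pu)      e px = step pu e (here px)
  extend (step pu e′ r) e px = step pu e′ (extend r e px)

  reverse : ∀ {u w} → Walk G P u w → Walk G P w u
  reverse (here pu)             = here pu
  reverse (step {u} {w} pu e r) = extend (reverse r) (trans (Graph.sym G w u) e) pu

  _++_ : ∀ {u w x} → Walk G P u w → Walk G P w x → Walk G P u x
  here _     ++ r′ = r′
  step p e r ++ r′ = step p e (r ++ r′)

module _ (G : Graph n) {u w : Fin n} where

  ∈N∩⁺ : {S : Subset n} → adj G u w ≡ true → w ∈ S → w ∈ N G u ∩ S
  ∈N∩⁺ uw w∈S = x∈p∩q⁺ (x∈tabulate⁺ (adj G u) uw , w∈S)

  ∈N∩⁻ : (S : Subset n) → w ∈ N G u ∩ S → adj G u w ≡ true × w ∈ S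
  ∈N∩⁻ S w∈N∩S with x∈p∩q⁻ (N G u) S w∈N∩S
  ... | w∈N , w∈S = x∈tabulate⁻ (adj G u) w∈N , w∈S

ZeroOrAtLeastTwo : ℕ → Set
ZeroOrAtLeastTwo k = k ≡ 0 ⊎ 2 ≤ k

module FortAvoidingVertex (G : Graph n) (v : Fin n) (F : Subset n) (v∉F : v ∉ F) where

  _~_ : Fin n → Fin n → Set
  _~_ = SameComponentMinus G v

  ∈F⇒≢v : ∀ {w} → w ∈ F → w ≢ v
  ∈F⇒≢v w∈F refl = v∉F w∈F

  NeighbourInComponentOf : Fin n → Set
  NeighbourInComponentOf x = ∃[ w ] (w ∈ F × adj G v w ≡ true × x ~ w)

  module WithoutComponent {X : Fin n} (component? : Decidable (X ~_)) where

    F′ : Subset n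
    F′ = F ∩ ∁ (toSubset component?)

    ∈F′⁺ : ∀ {u} → u ∈ F → ¬ X ~ u → u ∈ F′
    ∈F′⁺ u∈F X≁u = x∈p∩q⁺ (u∈F , x∉p⇒x∈∁p (X≁u ∘ x∈toSubset⁻ component?))

    ∈F′⁻ : ∀ {u} → u ∈ F′ → u ∈ F × ¬ X ~ u
    ∈F′⁻ u∈F′ with x∈p∩q⁻ F _ u∈F′
    ... | u∈F , u∈∁C = u∈F , x∈∁p⇒x∉p u∈∁C ∘ x∈toSubset⁺ component?

    F′⊂F : X ∈ F → F′ ⊂ F
    F′⊂F X∈F = p∩q⊆p F _ , X , X∈F , λ X∈F′ → proj₂ (∈F′⁻ X∈F′) (here (∈F⇒≢v X∈F))

    ∣N∩F′∣≡0-inside : ∀ {u} → X ~ u → ∣ N G u ∩ F′ ∣ ≡ 0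
    ∣N∩F′∣≡0-inside X~u = Empty⇒∣p∣≡0 λ (w , w∈N∩F′) →
      let uw , w∈F′ = ∈N∩⁻ G F′ w∈N∩F′
          w∈F , X≁w = ∈F′⁻ w∈F′
      in X≁w (extend X~u uw (∈F⇒≢v w∈F))

    N∩F′≡N∩F : ∀ {u} → (∀ {w} → w ∈ N G u ∩ F → ¬ X ~ w) → N G u ∩ F′ ≡ N G u ∩ F
    N∩F′≡N∩F {u} away = begin
      N G u ∩ (F ∩ ∁ C)  ≡⟨ sym (∩-assoc (N G u) F (∁ C)) ⟩
      (N G u ∩ F) ∩ ∁ C  ≡⟨ p∩∁q≡p (λ w∈ → away w∈ ∘ x∈toSubset⁻ component?) ⟩
      N G u ∩ F          ∎
      where
      open ≡-Reasoning
      C = toSubset component?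

    N∩F′≡N∩F-outside : ∀ {u} → u ≢ v → ¬ X ~ u → N G u ∩ F′ ≡ N G u ∩ F
    N∩F′≡N∩F-outside {u} u≢v X≁u = N∩F′≡N∩F λ {w} w∈N∩F X~w →
      X≁u (extend X~w (trans (Graph.sym G w u) (proj₁ (∈N∩⁻ G F w∈N∩F))) u≢v)

    isFort-F′ : IsFort G F → Nonempty F′ → ZeroOrAtLeastTwo ∣ N G v ∩ F′ ∣ → IsFort G F′
    isFort-F′ (_ , fortF) nonempty at-v = nonempty , fortF′
      where
      fortF′ : ∀ u → u ∉ F′ → ZeroOrAtLeastTwo ∣ N G u ∩ F′ ∣
      fortF′ u u∉F′ with component? u | u ≟ v
      ... | yes X~u | _        = inj₁ (∣N∩F′∣≡0-inside X~u)
      ... | no _    | yes refl = at-v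
      ... | no X≁u  | no u≢v   =
        subst (ZeroOrAtLeastTwo ∘ ∣_∣) (sym (N∩F′≡N∩F-outside u≢v X≁u))
              (fortF u (λ u∈F → u∉F′ (∈F′⁺ u∈F X≁u)))

    ¬fortCondition-at-v : IsMinimalFort G F → X ∈ F → Nonempty F′ → ¬ ZeroOrAtLeastTwo ∣ N G v ∩ F′ ∣
    ¬fortCondition-at-v (fortF , minimal) X∈F nonempty at-v =
      minimal F′ (F′⊂F X∈F) (isFort-F′ fortF nonempty at-v)

  module Minimal (minimal : IsMinimalFort G F) where

    neighbourInComponentOf-member : ∀ {X Y} → X ∈ F → Y ∈ F → ¬ X ~ Y → ¬ ¬ NeighbourInComponentOf X
    neighbourInComponentOf-member {X} X∈F Y∈F X≁Y no-neighbour =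
      ¬¬-decidable (X ~_) λ component? →
      let open WithoutComponent component?
          away : ∀ {w} → w ∈ N G v ∩ F → ¬ X ~ w
          away w∈N∩F X~w = let vw , w∈F = ∈N∩⁻ G F w∈N∩F in no-neighbour (_ , w∈F , vw , X~w)
          at-v = subst (ZeroOrAtLeastTwo ∘ ∣_∣) (sym (N∩F′≡N∩F away)) (proj₂ (proj₁ minimal) v v∉F)
      in ¬fortCondition-at-v minimal X∈F (_ , ∈F′⁺ Y∈F X≁Y) at-v

    neighbourInComponentOf-unique : ∀ {X Y Z} → X ∈ F → ¬ X ~ Y → ¬ X ~ Z →
      NeighbourInComponentOf Y → NeighbourInComponentOf Z → ¬ ¬ Y ~ Z
    neighbourInComponentOf-unique {X} X∈F X≁Y X≁Z (y , y∈F , vy , Y~y) (z , z∈F , vz , Z~z) Y≁Z =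
      ¬¬-decidable (X ~_) λ component? →
      let open WithoutComponent component?
          y∈F′ = ∈F′⁺ y∈F (λ X~y → X≁Y (X~y ++ reverse Y~y))
          z∈F′ = ∈F′⁺ z∈F (λ X~z → X≁Z (X~z ++ reverse Z~z))
          y≢z : y ≢ z
          y≢z = λ { refl → Y≁Z (Y~y ++ reverse Z~z) }
          at-v = inj₂ (x∈p∧y∈p∧x≢y⇒2≤∣p∣ (∈N∩⁺ G vy y∈F′) (∈N∩⁺ G vz z∈F′) y≢z)
      in ¬fortCondition-at-v minimal X∈F (_ , y∈F′) at-v

lemma7 : ∀ {n} (G : Graph n) (v : Fin n) → Connected G → IsCutVertex G v →
    (F : Subset n) → IsMinimalFort G F → v ∉ F →
    ¬ (∃[ a ] ∃[ b ] ∃[ c ] (a ∈ F × b ∈ F × c ∈ F ×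
        ¬ SameComponentMinus G v a b × ¬ SameComponentMinus G v a c ×
        ¬ SameComponentMinus G v b c))
lemma7 G v _ _ F minimal v∉F (a , b , c , a∈F , b∈F , c∈F , a≁b , a≁c , b≁c) =
  neighbourInComponentOf-member b∈F a∈F (a≁b ∘ reverse) λ nb →
  neighbourInComponentOf-member c∈F a∈F (a≁c ∘ reverse) λ nc →
  neighbourInComponentOf-unique a∈F a≁b a≁c nb nc b≁c
  where
  open FortAvoidingVertex G v F v∉F
  open Minimal minimal
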